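{- Let $\mathbb{G}=(V,E,T)$ be a temporal graph and $\Delta\in\mathbb{N}$. For every time-maximal $\Delta$-clique $R$ of $\mathbb{G}$, there is at most one (recursive) call of the procedure $\textsc{BronKerboschDelta}$ described in the context, started with the initial call $P=\{(v,T)\mid v\in V\}$, $R=(\emptyset,T)$, $X=\emptyset$, that has $R$ as its $R$-argument.
   Context: A temporal graph $\mathbb{G}=(V,E,T)$ consists of a finite vertex set $V$, an integer time interval $T=[\alpha,\omega]$, and a set of time-edges $E\subseteq\binom{V}{2}\times T$. All intervals are intervals of integers; for an interval $J=[a,b]$ write $|J|=b-a$. A $\Delta$-clique is a tuple $(C,I=[a,b])$ with $C\subseteq V$, $b-a\ge\Delta$, $I\subseteq T$, such that for all $\tau\in[a,b-\Delta]$ and all distinct $v,w\in C$ there is $(\{v,w\},t)\in E$ with $t\in[\tau,\tau+\Delta]$. It is time-maximal if there is no $\Delta$-clique $(C',I')$ with $I\subsetneq I'$ and $C\subseteq C'$. A vertex-interval pair is a tuple $(v,I)$ with $v\in V$, $I\subseteq T$ an interval. $\Delta$-neighborhood: $N^{\Delta}(v,I)$ is the set of all $(w,I'=[a',b'])$ such that $b'-a'\ge\Delta$, $I'\subseteq I$, for every $\tau\in[a',b'-\Delta]$ there is $(\{v,w\},t)\in E$ with $t\in[\tau,\tau+\Delta]$, and $I'$ is inclusion-maximal among subintervals of $I$ with these properties. $\Delta$-cut: $Y\sqcap Z=\{(v,I\cap I')\mid (v,I)\in Y,\ (v,I')\in Z,\ |I\cap I'|\ge\Delta\}$. Procedure $\textsc{BronKerboschDelta}(P,R=(C,I),X)$: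 (1) if every $(w,I')\in P\cup X$ satisfies $I'\subsetneq I$, add $R$ to the solution; (2) for each $(v,I')\in P$ (iterating over the current $P$): set $R'=(C\cup\{v\},I')$, $P'=P\sqcap N^{\Delta}(v,I')$, $X'=X\sqcap N^{\Delta}(v,I')$, call $\textsc{BronKerboschDelta}(P',R',X')$, then remove $(v,I')$ from $P$ and add it to $X$. -}

module Defs where

open import Data.Nat using (ℕ; zero; suc; _+_; _≤_; _⊔_; _⊓_)
import Data.Nat as ℕ
open import Data.Bool using (Bool; true; false)
import Data.Bool.Properties as BoolP
open import Data.Fin using (Fin)
open import Data.Fin.Subset using (Subset; ⁅_⁆; _∪_) renaming (⊥ to ∅; _∈_ to _∈ₛ_; _⊆_ to _⊆ₛ_)
open import Data.List using (List; []; _∷_; map; allFin)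
open import Data.List.Membership.Propositional using (_∈_)
open import Data.List.Relation.Unary.Unique.Propositional using (Unique)
open import Data.Product using (Σ; ∃; _×_; _,_; proj₁; proj₂)
import Data.Product.Properties as ProdP
import Data.Vec.Properties as VecP
open import Data.Sum using (_⊎_)
open import Data.Empty using (⊥)
open import Relation.Nullary using (¬_; does)
open import Relation.Binary.PropositionalEquality using (_≡_; _≢_)
open import Relation.Binary.Definitions using (DecidableEquality)

-- Temporal graph with vertex set Fin n, lifetime T = [α, ω] (times are naturals),
-- and time-edges given as a finite list of (u , w , t), read as ({u,w}, t).
record TemporalGraph (n : ℕ) : Set where
  field
    α ω   : ℕ
    E     : List (Fin n × Fin n × ℕ)
    E-ok  : ∀ {u w t} → (u , w , t) ∈ E → (u ≢ w) × (α ≤ t) × (t ≤ ω)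

-- An integer interval [a , b] is represented by the pair (a , b).
Interval : Set
Interval = ℕ × ℕ

_LongFor_ : Interval → ℕ → Set
(a , b) LongFor Δ = a + Δ ≤ b

_⊆ᵢ_ : Interval → Interval → Set
(a' , b') ⊆ᵢ (a , b) = (a ≤ a') × (b' ≤ b)

_⊊ᵢ_ : Interval → Interval → Set
J ⊊ᵢ I = (J ⊆ᵢ I) × (J ≢ I)

_∩ᵢ_ : Interval → Interval → Interval
(a , b) ∩ᵢ (a' , b') = (a ⊔ a' , b ⊓ b')

VI : ℕ → Set
VI n = Fin n × Interval

Clq : ℕ → Set
Clq n = Subset n × Interval

_≟ᶜ_ : ∀ {n} → DecidableEquality (Clq n)
_≟ᶜ_ = ProdP.≡-dec (VecP.≡-dec BoolP._≟_) (ProdP.≡-dec ℕ._≟_ ℕ._≟_)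

module _ {n : ℕ} (G : TemporalGraph n) (Δ : ℕ) where
  open TemporalGraph G

  T : Interval
  T = (α , ω)

  HasEdge : Fin n → Fin n → ℕ → Set
  HasEdge v w t = ((v , w , t) ∈ E) ⊎ ((w , v , t) ∈ E)

  Linked : Fin n → Fin n → Interval → Set
  Linked v w (a , b) = ∀ τ → a ≤ τ → τ + Δ ≤ b →
    ∃ λ t → HasEdge v w t × (τ ≤ t) × (t ≤ τ + Δ)

  IsΔClique : Clq n → Set
  IsΔClique (C , I) = (I LongFor Δ) × (I ⊆ᵢ T) ×
    (∀ v w → v ∈ₛ C → w ∈ₛ C → v ≢ w → Linked v w I)

  TimeMaximal : Clq n → Set
  TimeMaximal (C , I) = IsΔClique (C , I) ×
    (∀ C' I' → IsΔClique (C' , I') → I ⊊ᵢ I' → C ⊆ₛ C' → ⊥)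

  NbCand : Fin n → Interval → Fin n → Interval → Set
  NbCand v I w J = (J LongFor Δ) × (J ⊆ᵢ I) × Linked v w J

  Nbhd : VI n → VI n → Set
  Nbhd (v , I) (w , J) = NbCand v I w J ×
    (∀ J' → NbCand v I w J' → J ⊆ᵢ J' → J' ≡ J)

  Cut : (VI n → Set) → (VI n → Set) → VI n → Set
  Cut Y Z x = ∃ λ v → ∃ λ I → ∃ λ I' → Y (v , I) × Z (v , I') ×
    ((I ∩ᵢ I') LongFor Δ) × (x ≡ (v , I ∩ᵢ I'))

  _∈L : List (VI n) → VI n → Set
  (L ∈L) x = x ∈ L

  Represents : List (VI n) → (VI n → Set) → Set
  Represents L S = ∀ x → (x ∈ L → S x) × (S x → x ∈ L)

  extend : Clq n → VI n → Clq n
  extend (C , I) (v , I') = (C ∪ ⁅ v ⁆ , I')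

  -- An execution (recursion tree) of BronKerboschDelta(P, R, X).
  -- A call chooses an enumeration ps (duplicate free) of the current set P,
  -- and processes it in this order (Loop).  Loop rest R X processes the
  -- remaining elements 'rest' (= current P) with current X.
  mutual
    data Run (P : List (VI n)) (R : Clq n) (X : List (VI n)) : Set where
      call : (ps : List (VI n)) → Unique ps → Represents ps (P ∈L) →
             Loop ps R X → Run P R X

    data Loop : List (VI n) → Clq n → List (VI n) → Set where
      done : ∀ {R X} → Loop [] R X
      step : ∀ {p rest R X} (P' X' : List (VI n)) →
             Represents P' (Cut ((p ∷ rest) ∈L) (Nbhd p)) →
             Represents X' (Cut (X ∈L) (Nbhd p)) →
             Run P' (extend R p) X' →
             Loop rest R (p ∷ X) →
             Loop (p ∷ rest) R X

  mutual
    countRun : ∀ {P R X} → Run P R X → Clq n → ℕ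
    countRun {R = R} (call ps u r l) S =
      (if-yes (does (R ≟ᶜ S))) + countLoop l S

    countLoop : ∀ {Q R X} → Loop Q R X → Clq n → ℕ
    countLoop done S = 0
    countLoop (step P' X' _ _ r l) S = countRun r S + countLoop l S

    if-yes : Bool → ℕ
    if-yes true = 1
    if-yes false = 0

  P₀ : List (VI n)
  P₀ = map (λ v → (v , T)) (allFin n)

  R₀ : Clq n
  R₀ = (∅ , T)

-- Fix a Δ-clique S = (C_S, I_S). Along the recursion C only grows and the
-- intervals only shrink, so a call leads to S only if C ⊆ C_S and I_S ⊆ I.
-- Call it blocked when X holds some (v, L) with v ∈ C_S and I_S ⊆ L: then it is
-- not S, as X is disjoint from C, and every child that may still lead to S adds
-- some u ∈ C_S, u ≠ v, with I_S ⊆ K for its interval K; as u and v are linked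
-- on I_S, the Δ-neighbourhood of (u, K) holds some (v, L') with I_S ⊆ L', so the
-- child is blocked too. In a loop, the first step (u, K) with u ∈ C_S and
-- I_S ⊆ K puts (u, K) into X and so blocks all later steps: S is reached along
-- at most one path. Here u ≠ v because the pairs of a vertex in P never
-- Δ-overlap its pairs in X.
module Submission where

open import Defs
open import Data.Nat using (ℕ; zero; suc; pred; _+_; _∸_; _≤_; _<_; _⊔_; _⊓_; _≤?_; _<?_; z≤n; s≤s; s≤s⁻¹)
open import Data.Nat.Properties
open import Data.Fin using (Fin)
import Data.Fin.Properties as Fin
open import Data.Fin.Subset using (Subset; ⁅_⁆; _∪_) renaming (⊥ to ∅; _∈_ to _∈ₛ_)
open import Data.Fin.Subset.Properties using (p⊆p∪q; q⊆p∪q; x∈⁅x⁆; ∉⊥; x∈p∪q⁻; x∈⁅y⁆⇒x≡y)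
  renaming (_∈?_ to _∈ₛ?_)
open import Data.List using (List; []; _∷_)
open import Data.List.Membership.Propositional using (_∈_)
open import Data.List.Membership.Propositional.Properties using (∈-map⁻)
open import Data.List.Relation.Unary.Any using (here; there)
open import Data.List.Relation.Unary.All as All using (All)
open import Data.List.Relation.Unary.Unique.Propositional using (Unique)
open import Data.List.Relation.Unary.AllPairs using (_∷_)
open import Data.Product using (∃; _×_; _,_; proj₁; proj₂)
import Data.Product.Properties as Product
open import Data.Sum using (_⊎_; inj₁; inj₂; [_,_]′)
open import Data.Empty using (⊥-elim)
open import Relation.Nullary using (¬_; Dec; yes; no)
open import Relation.Nullary.Decidable using (_×-dec_; _⊎-dec_; map′)
open import Relation.Unary using (Decidable)
open import Relation.Binary.PropositionalEquality using (_≡_; _≢_; refl; sym; trans; cong; cong₂; subst)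

≤-⊔-split : ∀ {x} m n → x ≤ m ⊔ n → x ≤ m ⊎ x ≤ n
≤-⊔-split m n x≤m⊔n =
  [ (λ e → inj₁ (subst (_ ≤_) e x≤m⊔n)) , (λ e → inj₂ (subst (_ ≤_) e x≤m⊔n)) ]′ (⊔-sel m n)

⊓-≤-split : ∀ {x} m n → m ⊓ n ≤ x → m ≤ x ⊎ n ≤ x
⊓-≤-split m n m⊓n≤x =
  [ (λ e → inj₁ (subst (_≤ _) e m⊓n≤x)) , (λ e → inj₂ (subst (_≤ _) e m⊓n≤x)) ]′ (⊓-sel m n)

module _ {p} {P : ℕ → Set p} (P? : Decidable P) where

  longest-run-above : ∀ {s m} → s ≤ m →
    ∃ λ s' → s ≤ s' × s' ≤ m × (∀ {τ} → s < τ → τ ≤ s' → P τ) × (s' < m → ¬ P (suc s'))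
  longest-run-above {m = zero} z≤n = 0 , z≤n , z≤n , (λ { (s≤s _) () }) , λ ()
  longest-run-above {s} {suc m} s≤1+m with m≤n⇒m<n∨m≡n s≤1+m
  ... | inj₂ refl = s , ≤-refl , ≤-refl , (λ s<τ τ≤s → ⊥-elim (<⇒≱ s<τ τ≤s)) , λ s<s → ⊥-elim (<-irrefl refl s<s)
  ... | inj₁ (s≤s s≤m) with longest-run-above s≤m
  ...   | s' , s≤s' , s'≤m , run , stop with P? (suc s')
  ...     | no ¬P = s' , s≤s' , m≤n⇒m≤1+n s'≤m , run , λ _ → ¬P
  ...     | yes P[1+s'] = suc s' , m≤n⇒m≤1+n s≤s' , s≤s s'≤m , run′ , λ s'<m → ⊥-elim (stop (s≤s⁻¹ s'<m) P[1+s'])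
    where
    run′ : ∀ {τ} → s < τ → τ ≤ suc s' → P τ
    run′ s<τ τ≤1+s' with m≤n⇒m<n∨m≡n τ≤1+s'
    ... | inj₁ (s≤s τ≤s') = run s<τ τ≤s'
    ... | inj₂ refl = P[1+s']

  longest-run-below : ∀ {k a} → k ≤ a →
    ∃ λ c → k ≤ c × c ≤ a × (∀ {τ} → c ≤ τ → τ < a → P τ) × (k < c → ¬ P (pred c))
  longest-run-below {a = zero} z≤n = 0 , z≤n , z≤n , (λ _ ()) , λ ()
  longest-run-below {k} {suc a} k≤1+a with m≤n⇒m<n∨m≡n k≤1+a
  ... | inj₂ refl = k , ≤-refl , ≤-refl , (λ k≤τ τ<k → ⊥-elim (<⇒≱ τ<k k≤τ)) , λ k<k → ⊥-elim (<-irrefl refl k<k)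
  ... | inj₁ (s≤s k≤a) with P? a
  ...   | no ¬P = suc a , k≤1+a , ≤-refl , (λ 1+a≤τ τ<1+a → ⊥-elim (<⇒≱ τ<1+a 1+a≤τ)) , λ _ → ¬P
  ...   | yes P[a] with longest-run-below k≤a
  ...     | c , k≤c , c≤a , run , stop = c , k≤c , m≤n⇒m≤1+n c≤a , run′ , stop
    where
    run′ : ∀ {τ} → c ≤ τ → τ < suc a → P τ
    run′ c≤τ (s≤s τ≤a) with m≤n⇒m<n∨m≡n τ≤a
    ... | inj₁ τ<a = run c≤τ τ<a
    ... | inj₂ refl = P[a]

⊆ᵢ-refl : ∀ {J} → J ⊆ᵢ J
⊆ᵢ-refl = ≤-refl , ≤-refl

⊆ᵢ-trans : ∀ {J K L} → J ⊆ᵢ K → K ⊆ᵢ L → J ⊆ᵢ L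
⊆ᵢ-trans (a≤a' , b'≤b) (c≤a , b≤d) = ≤-trans c≤a a≤a' , ≤-trans b'≤b b≤d

_⊆ᵢ?_ : ∀ J K → Dec (J ⊆ᵢ K)
(a' , b') ⊆ᵢ? (a , b) = (a ≤? a') ×-dec (b' ≤? b)

LongFor-mono : ∀ {Δ J K} → J LongFor Δ → J ⊆ᵢ K → K LongFor Δ
LongFor-mono {Δ} long (c≤a , b≤d) = ≤-trans (+-monoˡ-≤ Δ c≤a) (≤-trans long b≤d)

∩ᵢ-⊆ˡ : ∀ J K → (J ∩ᵢ K) ⊆ᵢ J
∩ᵢ-⊆ˡ (a , b) (a' , b') = m≤m⊔n a a' , m⊓n≤m b b'

∩ᵢ-⊆ʳ : ∀ J K → (J ∩ᵢ K) ⊆ᵢ K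
∩ᵢ-⊆ʳ (a , b) (a' , b') = m≤n⊔m a a' , m⊓n≤n b b'

∩ᵢ-glb : ∀ {J K L} → L ⊆ᵢ J → L ⊆ᵢ K → L ⊆ᵢ (J ∩ᵢ K)
∩ᵢ-glb (a≤c , d≤b) (a'≤c , d≤b') = ⊔-lub a≤c a'≤c , ⊓-glb d≤b d≤b'

-- The convex hull, which is the union only for overlapping intervals.
_∪ᵢ_ : Interval → Interval → Interval
(a , b) ∪ᵢ (a' , b') = (a ⊓ a' , b ⊔ b')

∪ᵢ-⊆ˡ : ∀ J K → J ⊆ᵢ (J ∪ᵢ K)
∪ᵢ-⊆ˡ (a , b) (a' , b') = m⊓n≤m a a' , m≤m⊔n b b'

∪ᵢ-⊆ʳ : ∀ J K → K ⊆ᵢ (J ∪ᵢ K)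
∪ᵢ-⊆ʳ (a , b) (a' , b') = m⊓n≤n a a' , m≤n⊔m b b'

∪ᵢ-lub : ∀ {J K L} → J ⊆ᵢ L → K ⊆ᵢ L → (J ∪ᵢ K) ⊆ᵢ L
∪ᵢ-lub (c≤a , b≤d) (c≤a' , b'≤d) = ⊓-glb c≤a c≤a' , ⊔-lub b≤d b'≤d

module _ {n : ℕ} (G : TemporalGraph n) (Δ : ℕ) where
  open TemporalGraph G

  HasEdge? : ∀ v w t → Dec (HasEdge G Δ v w t)
  HasEdge? v w t = (v , w , t) ∈? E ⊎-dec (w , v , t) ∈? E
    where open import Data.List.Membership.DecPropositional
                (Product.≡-dec Fin._≟_ (Product.≡-dec Fin._≟_ _≟_)) using (_∈?_)

  HasEdge-irrefl : ∀ {v t} → ¬ HasEdge G Δ v v t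
  HasEdge-irrefl (inj₁ e) = proj₁ (E-ok e) refl
  HasEdge-irrefl (inj₂ e) = proj₁ (E-ok e) refl

  EdgeIn : Fin n → Fin n → ℕ → Set
  EdgeIn v w τ = ∃ λ t → HasEdge G Δ v w t × τ ≤ t × t ≤ τ + Δ

  EdgeIn? : ∀ v w → Decidable (EdgeIn v w)
  EdgeIn? v w τ =
    map′ (λ (t , t<1+τ+Δ , e , τ≤t) → t , e , τ≤t , s≤s⁻¹ t<1+τ+Δ)
         (λ (t , e , τ≤t , t≤τ+Δ) → t , s≤s t≤τ+Δ , e , τ≤t)
         (anyUpTo? (λ t → HasEdge? v w t ×-dec τ ≤? t) (suc (τ + Δ)))

  Overlap : Interval → Interval → Set
  Overlap J K = ∃ λ L → L LongFor Δ × L ⊆ᵢ J × L ⊆ᵢ K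

  Overlap-∩ˡ : ∀ {J J' K K'} → Overlap (J ∩ᵢ J') (K ∩ᵢ K') → Overlap J K
  Overlap-∩ˡ {J} {J'} {K} {K'} (L , long , L⊆ , L⊆′) =
    L , long , ⊆ᵢ-trans L⊆ (∩ᵢ-⊆ˡ J J') , ⊆ᵢ-trans L⊆′ (∩ᵢ-⊆ˡ K K')

  Overlap-∩ʳ : ∀ {J J' K K'} → Overlap (J ∩ᵢ J') (K ∩ᵢ K') → Overlap J' K'
  Overlap-∩ʳ {J} {J'} {K} {K'} (L , long , L⊆ , L⊆′) =
    L , long , ⊆ᵢ-trans L⊆ (∩ᵢ-⊆ʳ J J') , ⊆ᵢ-trans L⊆′ (∩ᵢ-⊆ʳ K K')

  -- A window starting before the overlap ends inside both intervals, one
  -- starting inside it starts inside both.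
  Linked-∪ᵢ : ∀ {v w J K} → Overlap J K →
    Linked G Δ v w J → Linked G Δ v w K → Linked G Δ v w (J ∪ᵢ K)
  Linked-∪ᵢ {J = a , b} {a' , b'} ((c , d) , c+Δ≤d , (a≤c , d≤b) , (a'≤c , d≤b')) lJ lK τ a⊓a'≤τ τ+Δ≤b⊔b'
    with c ≤? τ
  ... | yes c≤τ =
    [ lJ τ (≤-trans a≤c c≤τ) , lK τ (≤-trans a'≤c c≤τ) ]′ (≤-⊔-split b b' τ+Δ≤b⊔b')
  ... | no c≰τ =
    [ (λ a≤τ → lJ τ a≤τ (≤-trans τ+Δ≤d d≤b)) , (λ a'≤τ → lK τ a'≤τ (≤-trans τ+Δ≤d d≤b')) ]′
      (⊓-≤-split a a' a⊓a'≤τ)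
    where
    τ+Δ≤d : τ + Δ ≤ d
    τ+Δ≤d = ≤-trans (+-monoˡ-≤ Δ (<⇒≤ (≰⇒> c≰τ))) c+Δ≤d

  Nbhd-irrefl : ∀ {v I w J} → Nbhd G Δ (v , I) (w , J) → v ≢ w
  Nbhd-irrefl {J = a , b} ((long , _ , linked) , _) refl =
    HasEdge-irrefl (proj₁ (proj₂ (linked a ≤-refl long)))

  Nbhd-separated : ∀ {v I w J K} →
    Nbhd G Δ (v , I) (w , J) → Nbhd G Δ (v , I) (w , K) → Overlap J K → J ≡ K
  Nbhd-separated {v} {I} {w} {J} {K} ((J-long , J⊆I , lJ) , J-max) ((_ , K⊆I , lK) , K-max) J≬K =
    trans (sym (J-max (J ∪ᵢ K) hull (∪ᵢ-⊆ˡ J K))) (K-max (J ∪ᵢ K) hull (∪ᵢ-⊆ʳ J K))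
    where
    hull : NbCand G Δ v I w (J ∪ᵢ K)
    hull = LongFor-mono J-long (∪ᵢ-⊆ˡ J K) , ∪ᵢ-lub J⊆I K⊆I , Linked-∪ᵢ J≬K lJ lK

  -- Extend J = [a, s + Δ] by the longest runs of good windows to the right
  -- and to the left; a larger candidate would contain the first bad window.
  Nbhd-above : ∀ {v I w J} → NbCand G Δ v I w J → ∃ λ L → Nbhd G Δ (v , I) (w , L) × J ⊆ᵢ L
  Nbhd-above {v} {k₁ , k₂} {w} {a , b} (a+Δ≤b , (k₁≤a , b≤k₂) , linked)
    with longest-run-above (EdgeIn? v w) (∸-monoˡ-≤ Δ b≤k₂) | longest-run-below (EdgeIn? v w) k₁≤a
  ... | s' , s≤s' , s'≤m , right , right-stop | c , k₁≤c , c≤a , left , left-stop =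
    (c , s' + Δ) , ((c+Δ≤s'+Δ , (k₁≤c , s'+Δ≤k₂) , linked′) , maximal) , (c≤a , b≤s'+Δ)
    where
    s = b ∸ Δ
    Δ≤b = ≤-trans (m≤n+m Δ a) a+Δ≤b
    s+Δ≡b : s + Δ ≡ b
    s+Δ≡b = m∸n+n≡m Δ≤b
    k₂∸Δ+Δ≡k₂ : k₂ ∸ Δ + Δ ≡ k₂
    k₂∸Δ+Δ≡k₂ = m∸n+n≡m (≤-trans Δ≤b b≤k₂)
    c≤s' : c ≤ s'
    c≤s' = ≤-trans c≤a (≤-trans (m+n≤o⇒m≤o∸n a a+Δ≤b) s≤s')
    c+Δ≤s'+Δ = +-monoˡ-≤ Δ c≤s'
    s'+Δ≤k₂ = subst (s' + Δ ≤_) k₂∸Δ+Δ≡k₂ (+-monoˡ-≤ Δ s'≤m)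
    b≤s'+Δ = subst (_≤ s' + Δ) s+Δ≡b (+-monoˡ-≤ Δ s≤s')
    linked′ : Linked G Δ v w (c , s' + Δ)
    linked′ τ c≤τ τ+Δ≤s'+Δ with τ <? a | τ ≤? s
    ... | yes τ<a | _ = left c≤τ τ<a
    ... | no τ≮a | yes τ≤s = linked τ (≮⇒≥ τ≮a) (subst (τ + Δ ≤_) s+Δ≡b (+-monoˡ-≤ Δ τ≤s))
    ... | no _ | no τ≰s = right (≰⇒> τ≰s) (+-cancelʳ-≤ Δ τ (s') τ+Δ≤s'+Δ)
    maximal : ∀ J' → NbCand G Δ v (k₁ , k₂) w J' → (c , s' + Δ) ⊆ᵢ J' → J' ≡ (c , s' + Δ)
    maximal (c₂ , d₂) (_ , (k₁≤c₂ , d₂≤k₂) , linked₂) (c₂≤c , s'+Δ≤d₂) =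
      cong₂ _,_ (≤-antisym c₂≤c c≤c₂) (≤-antisym d₂≤s'+Δ s'+Δ≤d₂)
      where
      c≤c₂ : c ≤ c₂
      c≤c₂ with c ≤? c₂
      ... | yes c≤c₂ = c≤c₂
      ... | no c≰c₂ = ⊥-elim (left-stop (≤-<-trans k₁≤c₂ c₂<c)
        (linked₂ (pred c) (<⇒≤pred c₂<c) (≤-trans (+-monoˡ-≤ Δ (≤-trans pred[n]≤n c≤s')) s'+Δ≤d₂)))
        where c₂<c = ≰⇒> c≰c₂
      d₂≤s'+Δ : d₂ ≤ s' + Δ
      d₂≤s'+Δ with d₂ ≤? s' + Δ
      ... | yes d₂≤s'+Δ = d₂≤s'+Δ
      ... | no d₂≰s'+Δ = ⊥-elim (right-stop s'<k₂∸Δ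
        (linked₂ (suc s') (≤-trans c₂≤c (≤-trans c≤s' (n≤1+n s'))) s'+Δ<d₂))
        where
        s'+Δ<d₂ = ≰⇒> d₂≰s'+Δ
        s'<k₂∸Δ = +-cancelʳ-< Δ s' (k₂ ∸ Δ)
          (subst (s' + Δ <_) (sym k₂∸Δ+Δ≡k₂) (≤-trans s'+Δ<d₂ d₂≤k₂))

  record Invariant (P : List (VI n)) (C : Subset n) (I : Interval) (X : List (VI n)) : Set where
    field
      P-fresh     : ∀ {w J} → (w , J) ∈ P → ¬ w ∈ₛ C
      P-inside    : ∀ {w J} → (w , J) ∈ P → J ⊆ᵢ I
      X-fresh     : ∀ {w J} → (w , J) ∈ X → ¬ w ∈ₛ C
      P-separated : ∀ {w J K} → (w , J) ∈ P → (w , K) ∈ P → Overlap J K → J ≡ K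
      P-X-apart   : ∀ {w J K} → (w , J) ∈ P → (w , K) ∈ X → ¬ Overlap J K
  open Invariant

  Invariant-init : Invariant (P₀ G Δ) ∅ (T G Δ) []
  Invariant-init = record
    { P-fresh = λ _ → ∉⊥
    ; P-inside = λ m → subst (_⊆ᵢ T G Δ) (sym (in-P₀ m)) ⊆ᵢ-refl
    ; X-fresh = λ ()
    ; P-separated = λ m m' _ → trans (in-P₀ m) (sym (in-P₀ m'))
    ; P-X-apart = λ _ ()
    }
    where
    in-P₀ : ∀ {w J} → (w , J) ∈ P₀ G Δ → J ≡ T G Δ
    in-P₀ m with ∈-map⁻ (λ v → (v , T G Δ)) m
    ... | _ , _ , refl = refl

  Invariant-enumerate : ∀ {P ps C I X} → Represents G Δ ps (_∈L G Δ P) →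
    Invariant P C I X → Invariant ps C I X
  Invariant-enumerate ps≈P inv = record
    { P-fresh = λ m → P-fresh inv (from m)
    ; P-inside = λ m → P-inside inv (from m)
    ; X-fresh = X-fresh inv
    ; P-separated = λ m m' → P-separated inv (from m) (from m')
    ; P-X-apart = λ m → P-X-apart inv (from m)
    }
    where
    from : ∀ {x} → x ∈ _ → x ∈ _
    from {x} = proj₁ (ps≈P x)

  Invariant-advance : ∀ {p rest C I X} → All (p ≢_) rest →
    Invariant (p ∷ rest) C I X → Invariant rest C I (p ∷ X)
  Invariant-advance {p} {rest} {C} {I} {X} p∉rest inv = record
    { P-fresh = λ m → P-fresh inv (there m)
    ; P-inside = λ m → P-inside inv (there m)
    ; X-fresh = X-fresh′
    ; P-separated = λ m m' → P-separated inv (there m) (there m')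
    ; P-X-apart = P-X-apart′
    }
    where
    X-fresh′ : ∀ {w J} → (w , J) ∈ p ∷ X → ¬ w ∈ₛ C
    X-fresh′ (here refl) = P-fresh inv (here refl)
    X-fresh′ (there m) = X-fresh inv m
    P-X-apart′ : ∀ {w J K} → (w , J) ∈ rest → (w , K) ∈ p ∷ X → ¬ Overlap J K
    P-X-apart′ m (here refl) J≬K =
      All.lookup p∉rest m (sym (cong (_ ,_) (P-separated inv (there m) (here refl) J≬K)))
    P-X-apart′ m (there m') = P-X-apart inv (there m) m'

  Invariant-descend : ∀ {u K rest C I X P' X'} → Invariant ((u , K) ∷ rest) C I X →
    Represents G Δ P' (Cut G Δ (_∈L G Δ ((u , K) ∷ rest)) (Nbhd G Δ (u , K))) →
    Represents G Δ X' (Cut G Δ (_∈L G Δ X) (Nbhd G Δ (u , K))) →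
    Invariant P' (C ∪ ⁅ u ⁆) K X'
  Invariant-descend {u} {K} {rest} {C} {I} {X} {P'} {X'} inv P'≈ X'≈ = record
    { P-fresh = P-fresh′
    ; P-inside = P-inside′
    ; X-fresh = X-fresh′
    ; P-separated = P-separated′
    ; P-X-apart = P-X-apart′
    }
    where
    fresh : ∀ {w L} → ¬ w ∈ₛ C → Nbhd G Δ (u , K) (w , L) → ¬ w ∈ₛ (C ∪ ⁅ u ⁆)
    fresh w∉C nb w∈ = [ w∉C , (λ w∈⁅u⁆ → Nbhd-irrefl nb (sym (x∈⁅y⁆⇒x≡y u w∈⁅u⁆))) ]′ (x∈p∪q⁻ C ⁅ u ⁆ w∈)
    P-fresh′ : ∀ {w J} → (w , J) ∈ P' → ¬ w ∈ₛ (C ∪ ⁅ u ⁆)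
    P-fresh′ m with proj₁ (P'≈ _) m
    ... | _ , _ , _ , m₁ , nb , _ , refl = fresh (P-fresh inv m₁) nb
    P-inside′ : ∀ {w J} → (w , J) ∈ P' → J ⊆ᵢ K
    P-inside′ m with proj₁ (P'≈ _) m
    ... | _ , J₁ , J₂ , _ , ((_ , J₂⊆K , _) , _) , _ , refl = ⊆ᵢ-trans (∩ᵢ-⊆ʳ J₁ J₂) J₂⊆K
    X-fresh′ : ∀ {w J} → (w , J) ∈ X' → ¬ w ∈ₛ (C ∪ ⁅ u ⁆)
    X-fresh′ m with proj₁ (X'≈ _) m
    ... | _ , _ , _ , m₁ , nb , _ , refl = fresh (X-fresh inv m₁) nb
    P-separated′ : ∀ {w J J'} → (w , J) ∈ P' → (w , J') ∈ P' → Overlap J J' → J ≡ J'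
    P-separated′ m m' ov with proj₁ (P'≈ _) m | proj₁ (P'≈ _) m'
    ... | _ , J₁ , J₂ , m₁ , nb , _ , refl | _ , J₁' , J₂' , m₁' , nb' , _ , refl =
      cong₂ _∩ᵢ_ (P-separated inv m₁ m₁' (Overlap-∩ˡ {J₁} {J₂} {J₁'} {J₂'} ov))
                 (Nbhd-separated nb nb' (Overlap-∩ʳ {J₁} {J₂} {J₁'} {J₂'} ov))
    P-X-apart′ : ∀ {w J J'} → (w , J) ∈ P' → (w , J') ∈ X' → ¬ Overlap J J'
    P-X-apart′ m m' ov with proj₁ (P'≈ _) m | proj₁ (X'≈ _) m'
    ... | _ , J₁ , J₂ , m₁ , _ , _ , refl | _ , J₁' , J₂' , m₁' , _ , _ , refl =
      P-X-apart inv m₁ m₁' (Overlap-∩ˡ {J₁} {J₂} {J₁'} {J₂'} ov)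

  module _ {C-S : Subset n} {I-S : Interval} (clique : IsΔClique G Δ (C-S , I-S)) where

    S : Clq n
    S = (C-S , I-S)

    data Avoids (C : Subset n) (I : Interval) (X : List (VI n)) : Set where
      foreign : ∀ {v} → v ∈ₛ C → ¬ v ∈ₛ C-S → Avoids C I X
      narrow  : ¬ I-S ⊆ᵢ I → Avoids C I X
      blocked : ∀ {v L} → (v , L) ∈ X → v ∈ₛ C-S → I-S ⊆ᵢ L → Avoids C I X

    Avoids⇒≢ : ∀ {P C I X} → Invariant P C I X → Avoids C I X → (C , I) ≢ S
    Avoids⇒≢ _ (foreign v∈C v∉C-S) refl = v∉C-S v∈C
    Avoids⇒≢ _ (narrow I-S⊈I) refl = I-S⊈I ⊆ᵢ-refl
    Avoids⇒≢ inv (blocked m v∈C-S _) refl = X-fresh inv m v∈C-S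

    Avoids-advance : ∀ {C I X p} → Avoids C I X → Avoids C I (p ∷ X)
    Avoids-advance (foreign v∈C v∉C-S) = foreign v∈C v∉C-S
    Avoids-advance (narrow I-S⊈I) = narrow I-S⊈I
    Avoids-advance (blocked m v∈C-S I-S⊆L) = blocked (there m) v∈C-S I-S⊆L

    Avoids-uncovered : ∀ {C u K X} → ¬ (u ∈ₛ C-S × I-S ⊆ᵢ K) → Avoids (C ∪ ⁅ u ⁆) K X
    Avoids-uncovered {C} {u} {K} ¬cover with u ∈ₛ? C-S
    ... | no u∉C-S = foreign (q⊆p∪q C ⁅ u ⁆ (x∈⁅x⁆ u)) u∉C-S
    ... | yes u∈C-S = narrow λ I-S⊆K → ¬cover (u∈C-S , I-S⊆K)

    Avoids-descend : ∀ {u K rest C I X X'} → Invariant ((u , K) ∷ rest) C I X →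
      Represents G Δ X' (Cut G Δ (_∈L G Δ X) (Nbhd G Δ (u , K))) →
      Avoids C I X → Avoids (C ∪ ⁅ u ⁆) K X'
    Avoids-descend {u} _ _ (foreign v∈C v∉C-S) = foreign (p⊆p∪q ⁅ u ⁆ v∈C) v∉C-S
    Avoids-descend inv _ (narrow I-S⊈I) =
      narrow λ I-S⊆K → I-S⊈I (⊆ᵢ-trans I-S⊆K (P-inside inv (here refl)))
    Avoids-descend {u} {K} inv X'≈ (blocked {v} {L} m v∈C-S I-S⊆L) with u ∈ₛ? C-S ×-dec I-S ⊆ᵢ? K
    ... | no ¬cover = Avoids-uncovered ¬cover
    ... | yes (u∈C-S , I-S⊆K) with u Fin.≟ v
    ...   | yes refl = ⊥-elim (P-X-apart inv (here refl) m (I-S , proj₁ clique , I-S⊆K , I-S⊆L))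
    ...   | no u≢v with Nbhd-above (proj₁ clique , I-S⊆K , proj₂ (proj₂ clique) u v u∈C-S v∈C-S u≢v)
    ...     | L' , nb , I-S⊆L' = blocked (proj₂ (X'≈ _) (v , L , L' , m , nb , long , refl)) v∈C-S I-S⊆L∩L'
      where
      I-S⊆L∩L' = ∩ᵢ-glb I-S⊆L I-S⊆L'
      long = LongFor-mono (proj₁ clique) I-S⊆L∩L'

    mutual
      countRun-avoids : ∀ {P C I X} (r : Run G Δ P (C , I) X) →
        Invariant P C I X → Avoids C I X → countRun G Δ r S ≡ 0
      countRun-avoids {C = C} {I} (call ps uq ps≈P l) inv av with (C , I) ≟ᶜ S
      ... | yes C,I≡S = ⊥-elim (Avoids⇒≢ inv av C,I≡S)
      ... | no _ = countLoop-avoids l (Invariant-enumerate ps≈P inv) uq av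

      countLoop-avoids : ∀ {Q C I X} (l : Loop G Δ Q (C , I) X) →
        Invariant Q C I X → Unique Q → Avoids C I X → countLoop G Δ l S ≡ 0
      countLoop-avoids done _ _ _ = refl
      countLoop-avoids (step P' X' P'≈ X'≈ r l) inv (p∉rest ∷ uq) av =
        cong₂ _+_ (countRun-avoids r (Invariant-descend inv P'≈ X'≈) (Avoids-descend inv X'≈ av))
                  (countLoop-avoids l (Invariant-advance p∉rest inv) uq (Avoids-advance av))

    countLoop-at-S≡0 : ∀ {Q X} (l : Loop G Δ Q S X) → Invariant Q C-S I-S X → Unique Q →
      countLoop G Δ l S ≡ 0
    countLoop-at-S≡0 done _ _ = refl
    countLoop-at-S≡0 (step {p = u , K} P' X' P'≈ X'≈ r l) inv (p∉rest ∷ uq) =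
      cong₂ _+_ (countRun-avoids r (Invariant-descend inv P'≈ X'≈) u-foreign)
                (countLoop-at-S≡0 l (Invariant-advance p∉rest inv) uq)
      where
      u-foreign = foreign (q⊆p∪q C-S ⁅ u ⁆ (x∈⁅x⁆ u)) (P-fresh inv (here refl))

    mutual
      countRun≤1 : ∀ {P C I X} (r : Run G Δ P (C , I) X) → Invariant P C I X → countRun G Δ r S ≤ 1
      countRun≤1 {C = C} {I} (call ps uq ps≈P l) inv with (C , I) ≟ᶜ S
      ... | yes refl = ≤-reflexive (cong suc (countLoop-at-S≡0 l (Invariant-enumerate ps≈P inv) uq))
      ... | no _ = countLoop≤1 l (Invariant-enumerate ps≈P inv) uq

      countLoop≤1 : ∀ {Q C I X} (l : Loop G Δ Q (C , I) X) → Invariant Q C I X → Unique Q →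
        countLoop G Δ l S ≤ 1
      countLoop≤1 done _ _ = z≤n
      countLoop≤1 (step {p = u , K} P' X' P'≈ X'≈ r l) inv (p∉rest ∷ uq) with u ∈ₛ? C-S ×-dec I-S ⊆ᵢ? K
      ... | no ¬cover
        rewrite countRun-avoids r (Invariant-descend inv P'≈ X'≈) (Avoids-uncovered ¬cover) =
          countLoop≤1 l (Invariant-advance p∉rest inv) uq
      ... | yes (u∈C-S , I-S⊆K)
        rewrite countLoop-avoids l (Invariant-advance p∉rest inv) uq (blocked (here refl) u∈C-S I-S⊆K)
              | +-identityʳ (countRun G Δ r S) =
          countRun≤1 r (Invariant-descend inv P'≈ X'≈)

lemma3 : ∀ {n : ℕ} (G : TemporalGraph n) (Δ : ℕ) (R : Clq n) →
    TimeMaximal G Δ R →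
    (run : Run G Δ (P₀ G Δ) (R₀ G Δ) []) →
    countRun G Δ run R ≤ 1
lemma3 G Δ R (clique , _) run = countRun≤1 G Δ clique run (Invariant-init G Δ)
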